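{- Let $T$ be an amenable tableau. If $i$ or $i'$ appears in row $j$ of $T$, then $j\ge i$.
   Context: Use the alphabet $1'<1<2'<2<\cdots$. A tableau is a filling of the boxes of a (possibly skew or shifted) diagram by letters of this alphabet; rows are numbered from the top. Its reading word $w(T)$ lists entries of each row right to left, rows top to bottom; $\hat w(T)$ is $w(T)$ reversed with each entry replaced by its successor ($i'\mapsto i$, $i\mapsto(i+1)'$). A word is lattice if, whenever the number of $i$'s read so far equals the number of $(i+1)$'s read, the next symbol is neither $i+1$ nor $(i+1)'$. $T$ is amenable if rows and columns weakly increase, each row has at most one $i'$ and each column at most one $i$ for each $i$, the concatenation $w\hat w$ is lattice, and in $w$ the rightmost $i$ is to the right of the rightmost $i'$ for all $i$. -}

module Defs where

open import Data.Nat using (ℕ; zero; suc; _+_; _*_; _∸_; _≤_; _<_; _>_; _≡ᵇ_)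
open import Data.Bool using (Bool; true; false; if_then_else_)
open import Data.List using (List; []; _∷_; _++_; map; concatMap; reverse; downFrom; upTo; length)
open import Data.List.Membership.Propositional using (_∈_)
open import Data.Product using (_×_)
open import Relation.Binary.PropositionalEquality using (_≡_; _≢_)

-- Alphabet 1' < 1 < 2' < 2 < ...
-- plain i  represents the letter i, prime i represents i'.
-- (Letters of a tableau are required to have index ≥ 1, see Tableau.)

data Letter : Set where
  plain : ℕ → Letter
  prime : ℕ → Letter

key : Letter → ℕ
key (plain i) = 2 * i
key (prime i) = 2 * i ∸ 1

index : Letter → ℕ
index (plain i) = i
index (prime i) = i

_≤L_ : Letter → Letter → Set
x ≤L y = key x ≤ key y

succL : Letter → Letter
succL (prime i) = plain i
succL (plain i) = prime (suc i)

countPlain : ℕ → List Letter → ℕ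
countPlain i [] = 0
countPlain i (plain j ∷ u) = if i ≡ᵇ j then suc (countPlain i u) else countPlain i u
countPlain i (prime j ∷ u) = countPlain i u

-- Partitions as lists of parts; part λ r is the r-th part (rows numbered
-- from 1), and 0 beyond the length.

part : List ℕ → ℕ → ℕ
part []       _             = 0
part (x ∷ xs) zero          = 0
part (x ∷ xs) (suc zero)    = x
part (x ∷ xs) (suc (suc r)) = part xs (suc r)

data Decreasing : List ℕ → Set where
  []  : Decreasing []
  [_] : ∀ x → Decreasing (x ∷ [])
  _∷_ : ∀ {x y xs} → y ≤ x → Decreasing (y ∷ xs) → Decreasing (x ∷ y ∷ xs)

data StrictlyDecreasing : List ℕ → Set where
  []  : StrictlyDecreasing []
  [_] : ∀ x → StrictlyDecreasing (x ∷ [])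
  _∷_ : ∀ {x y xs} → y < x → StrictlyDecreasing (y ∷ xs) → StrictlyDecreasing (x ∷ y ∷ xs)

data AllPos : List ℕ → Set where
  []  : AllPos []
  _∷_ : ∀ {x xs} → 0 < x → AllPos xs → AllPos (x ∷ xs)

Partition : List ℕ → Set
Partition l = Decreasing l × AllPos l

StrictPartition : List ℕ → Set
StrictPartition l = StrictlyDecreasing l × AllPos l

-- Diagrams: ordinary skew shape λ/μ, or shifted skew shape λ/μ.

record Diagram : Set where
  field
    shifted : Bool
    outer   : List ℕ
    inner   : List ℕ
open Diagram public

ValidDiagram : Diagram → Set
ValidDiagram D with shifted D
... | false = Partition (outer D) × Partition (inner D) × (∀ r → part (inner D) r ≤ part (outer D) r)
... | true  = StrictPartition (outer D) × StrictPartition (inner D) × (∀ r → part (inner D) r ≤ part (outer D) r)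

-- leftmost column of row r (columns numbered from 1):
--   ordinary: μ_r + 1 ;  shifted: r + μ_r   (shifted row r of λ occupies columns r..r+λ_r-1)
rowStart : Diagram → ℕ → ℕ
rowStart D r with shifted D
... | false = suc (part (inner D) r)
... | true  = r + part (inner D) r

rowLength : Diagram → ℕ → ℕ
rowLength D r = part (outer D) r ∸ part (inner D) r

InD : Diagram → ℕ → ℕ → Set
InD D r c = (1 ≤ r) × (rowStart D r ≤ c) × (c < rowStart D r + rowLength D r)

record Tableau (D : Diagram) : Set where
  field
    entry    : ℕ → ℕ → Letter            -- only values on boxes of D matter
    positive : ∀ r c → InD D r c → 1 ≤ index (entry r c)
open Tableau public

readRow : {D : Diagram} → Tableau D → ℕ → List Letter
readRow {D} T r = map (λ k → entry T r (rowStart D r + k)) (downFrom (rowLength D r))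

w : {D : Diagram} → Tableau D → List Letter
w {D} T = concatMap (λ k → readRow T (suc k)) (upTo (length (outer D)))

ŵ : {D : Diagram} → Tableau D → List Letter
ŵ T = reverse (map succL (w T))

Lattice : List Letter → Set
Lattice u = ∀ (pre : List Letter) (x : Letter) (rest : List Letter) →
  u ≡ pre ++ x ∷ rest →
  ∀ i → 1 ≤ i → countPlain i pre ≡ countPlain (suc i) pre →
  (x ≢ plain (suc i)) × (x ≢ prime (suc i))

-- in u, the rightmost i is to the right of the rightmost i' (for every i):
-- every occurrence of i' is followed later by some i
RightmostCondition : List Letter → Set
RightmostCondition u = ∀ (pre rest : List Letter) i →
  u ≡ pre ++ prime i ∷ rest → plain i ∈ rest

record Amenable {D : Diagram} (T : Tableau D) : Set where
  field
    rowsWeak : ∀ r c c′ → InD D r c → InD D r c′ → c ≤ c′ → entry T r c ≤L entry T r c′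
    colsWeak : ∀ r r′ c → InD D r c → InD D r′ c → r ≤ r′ → entry T r c ≤L entry T r′ c
    rowPrime : ∀ r c c′ i → InD D r c → InD D r c′ →
               entry T r c ≡ prime i → entry T r c′ ≡ prime i → c ≡ c′
    colPlain : ∀ r r′ c i → InD D r c → InD D r′ c →
               entry T r c ≡ plain i → entry T r′ c ≡ plain i → r ≡ r′
    lattice  : Lattice (w T ++ ŵ T)
    rightmost : RightmostCondition (w T)

-- Read w(T) from the left: by the lattice property, the first letter
-- of index i+1 ≥ 2 must be preceded by an unprimed i. By induction that i lies in a
-- row ≥ i, and not in the same row as the letter i+1 — it would stand to the right of
-- a larger letter, against weak row increase. So the first letter of index i+1 lies in
-- a row ≥ i+1, and all later ones in rows at least as low.
module Submission where

open import Defs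
open import Data.Nat using (ℕ; zero; suc; _+_; _*_; _∸_; _≤_; _<_; z≤n; s≤s; s≤s⁻¹; _≡ᵇ_)
open import Data.Nat.Properties
open import Data.Bool using (true; false)
open import Data.Sum using (_⊎_; inj₁; inj₂; [_,_]′)
open import Data.Product using (_×_; _,_; proj₁; proj₂; ∃; ∃₂)
open import Data.List using (List; []; _∷_; _++_; map; concatMap; downFrom; upTo; length)
open import Data.List.Properties using (map-∘; map-++; ++-assoc; concatMap-cong; map-concatMap)
open import Data.List.Relation.Unary.All as All using (All; []; _∷_)
import Data.List.Relation.Unary.All.Properties as All
open import Data.List.Relation.Unary.Any as Any using (here; there)
open import Data.List.Relation.Unary.AllPairs as AllPairs using (AllPairs; []; _∷_)
import Data.List.Relation.Unary.AllPairs.Properties as AllPairs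
import Data.List.Relation.Unary.First as First
open import Data.List.Relation.Unary.First.Properties using (toView)
open import Data.List.Membership.Propositional using (_∈_; _∉_; lose)
open import Data.List.Membership.Propositional.Properties
  using (∈-map⁺; ∈-map⁻; ∈-++⁺ˡ; ∈-++⁺ʳ; ∈-++⁻; ∈-concatMap⁺; ∈-concatMap⁻; ∈-upTo⁺; ∈-downFrom⁺; ∈-downFrom⁻)
open import Data.Empty using (⊥-elim)
open import Function using (id)
open import Relation.Nullary using (¬_; yes; no; contradiction)
open import Relation.Nullary.Decidable using (toSum)
open import Relation.Unary using (∁; Decidable)
open import Relation.Binary.PropositionalEquality using (_≡_; refl; sym; trans; cong; subst; _≢_; module ≡-Reasoning)

AllPairs-split : ∀ {A : Set} {R : A → A → Set} xs {y ys} → AllPairs R (xs ++ y ∷ ys) →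
                 All (λ x → R x y) xs × All (R y) ys
AllPairs-split []       (Ry ∷ _)    = [] , Ry
AllPairs-split (x ∷ xs) (Rx ∷ Rxs) with AllPairs-split xs Rxs
... | before , after = All.head (All.++⁻ʳ xs Rx) ∷ before , after

firstOccurrence : ∀ {A : Set} {P : A → Set} → Decidable P → ∀ {xs} → Any.Any P xs →
                  ∃₂ λ pre y → ∃ λ post → xs ≡ pre ++ y ∷ post × All (∁ P) pre × P y
firstOccurrence P? any with toView (First.refine (λ {x} _ → toSum (P? x)) (First.fromAny any))
... | First._++_∷_ {pre} ¬Ps Py post = pre , _ , post , refl , ¬Ps , Py

first-precedes : ∀ {A : Set} {R : A → A → Set} {P : A → Set} pre {y post x} →
                 AllPairs R (pre ++ y ∷ post) → All (∁ P) pre → x ∈ pre ++ y ∷ post → P x → x ≡ y ⊎ R y x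
first-precedes pre sorted fresh x∈ Px with ∈-++⁻ pre x∈
... | inj₁ x∈pre          = contradiction Px (All.lookup fresh x∈pre)
... | inj₂ (here x≡y)     = inj₁ x≡y
... | inj₂ (there x∈post) = inj₂ (All.lookup (proj₂ (AllPairs-split pre sorted)) x∈post)

2*m≤1+2*n⇒m≤n : ∀ {m n} → 2 * m ≤ suc (2 * n) → m ≤ n
2*m≤1+2*n⇒m≤n {zero}            _  = z≤n
2*m≤1+2*n⇒m≤n {suc m} {zero}    le rewrite *-suc 2 m = contradiction le λ { (s≤s ()) }
2*m≤1+2*n⇒m≤n {suc m} {suc n}   le rewrite *-suc 2 m | *-suc 2 n =
  s≤s (2*m≤1+2*n⇒m≤n (s≤s⁻¹ (s≤s⁻¹ le)))

key≤2*index : ∀ x → key x ≤ 2 * index x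
key≤2*index (plain i) = ≤-refl
key≤2*index (prime i) = m∸n≤m (2 * i) 1

2*index≤1+key : ∀ x → 2 * index x ≤ suc (key x)
2*index≤1+key (plain i) = n≤1+n (2 * i)
2*index≤1+key (prime i) = m≤n+m∸n (2 * i) 1

index-mono-≤L : ∀ {x y} → x ≤L y → index x ≤ index y
index-mono-≤L {x} {y} x≤y = 2*m≤1+2*n⇒m≤n (begin
  2 * index x    ≤⟨ 2*index≤1+key x ⟩
  suc (key x)    ≤⟨ s≤s x≤y ⟩
  suc (key y)    ≤⟨ s≤s (key≤2*index y) ⟩
  suc (2 * index y) ∎)
  where open ≤-Reasoning

countPlain≢0⇒∈ : ∀ i u → countPlain i u ≢ 0 → plain i ∈ u
countPlain≢0⇒∈ i []            ≢0 = contradiction refl ≢0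
countPlain≢0⇒∈ i (prime j ∷ u) ≢0 = there (countPlain≢0⇒∈ i u ≢0)
countPlain≢0⇒∈ i (plain j ∷ u) ≢0 with i ≡ᵇ j | ≡ᵇ⇒≡ i j
... | true  | i≡j = here (cong plain (i≡j _))
... | false | _   = there (countPlain≢0⇒∈ i u ≢0)

∉⇒countPlain≡0 : ∀ i u → plain i ∉ u → countPlain i u ≡ 0
∉⇒countPlain≡0 i u i∉u with countPlain i u ≟ 0
... | yes ≡0 = ≡0
... | no  ≢0 = contradiction (countPlain≢0⇒∈ i u ≢0) i∉u

lattice⇒predecessor∈prefix : ∀ {u pre x rest i} → Lattice u → u ≡ pre ++ x ∷ rest → 1 ≤ i →
  index x ≡ suc i → All (λ y → index y ≢ suc i) pre → plain i ∈ pre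
lattice⇒predecessor∈prefix {pre = pre} {x} {i = i} lattice u≡ 1≤i x≡ fresh =
  countPlain≢0⇒∈ i pre λ no-i →
    excluded x x≡ (lattice pre x _ u≡ i 1≤i (trans no-i (sym (∉⇒countPlain≡0 (suc i) pre 1+i∉pre))))
  where
  1+i∉pre : plain (suc i) ∉ pre
  1+i∉pre ∈pre = All.lookup fresh ∈pre refl
  excluded : ∀ y → index y ≡ suc i → ¬ ((y ≢ plain (suc i)) × (y ≢ prime (suc i)))
  excluded (plain _) refl (≢plain , _) = ≢plain refl
  excluded (prime _) refl (_ , ≢prime) = ≢prime refl

Cell : Set
Cell = ℕ × ℕ

rowCells : Diagram → ℕ → List Cell
rowCells D r = map (λ k → r , rowStart D r + k) (downFrom (rowLength D r))

cells : Diagram → List Cell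
cells D = concatMap (λ k → rowCells D (suc k)) (upTo (length (outer D)))

-- The order in which w reads the cells: rows top to bottom, each right to left.
data _≺_ : Cell → Cell → Set where
  earlierRow   : ∀ {r r′ c c′} → r < r′ → (r , c) ≺ (r′ , c′)
  sameRowRight : ∀ {r c c′} → c′ < c → (r , c) ≺ (r , c′)

≺⇒row≤ : ∀ {p q} → p ≺ q → proj₁ p ≤ proj₁ q
≺⇒row≤ (earlierRow r<r′) = <⇒≤ r<r′
≺⇒row≤ (sameRowRight _)  = ≤-refl

rowCells-sorted : ∀ D r → AllPairs _≺_ (rowCells D r)
rowCells-sorted D r = AllPairs.map⁺ (AllPairs.applyDownFrom⁺₁ _ _ λ j<i _ →
  sameRowRight (+-monoʳ-< (rowStart D r) j<i))

rowCells-≺ : ∀ D {r r′} → r < r′ → All (λ p → All (p ≺_) (rowCells D r′)) (rowCells D r)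
rowCells-≺ D r<r′ = All.map⁺ (All.universal (λ _ → All.map⁺ (All.universal (λ _ → earlierRow r<r′) _)) _)

cells-sorted : ∀ D → AllPairs _≺_ (cells D)
cells-sorted D = AllPairs.concat⁺
  (All.map⁺ (All.universal (λ k → rowCells-sorted D (suc k)) (upTo n)))
  (AllPairs.map⁺ (AllPairs.applyUpTo⁺₁ id n λ k<k′ _ → rowCells-≺ D (s≤s k<k′)))
  where n = length (outer D)

∈-rowCells⁻ : ∀ D {r r′ c} → (r′ , c) ∈ rowCells D r →
              r′ ≡ r × rowStart D r ≤ c × c < rowStart D r + rowLength D r
∈-rowCells⁻ D {r} ∈row with ∈-map⁻ _ ∈row
... | k , k∈ , refl = refl , m≤m+n _ k , +-monoʳ-< (rowStart D r) (∈-downFrom⁻ k∈)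

∈-rowCells⁺ : ∀ D {r c} → rowStart D r ≤ c → c < rowStart D r + rowLength D r → (r , c) ∈ rowCells D r
∈-rowCells⁺ D {r} {c} start≤c c<end =
  subst (λ c′ → (r , c′) ∈ rowCells D r) (m+[n∸m]≡n start≤c) (∈-map⁺ _ (∈-downFrom⁺ offset<length))
  where
  offset<length : c ∸ rowStart D r < rowLength D r
  offset<length = +-cancelˡ-< (rowStart D r) _ _
    (subst (_< rowStart D r + rowLength D r) (sym (m+[n∸m]≡n start≤c)) c<end)

part-pos⇒≤length : ∀ xs r → 0 < part xs r → r ≤ length xs
part-pos⇒≤length (x ∷ xs) zero          _   = z≤n
part-pos⇒≤length (x ∷ xs) (suc zero)    _   = s≤s z≤n
part-pos⇒≤length (x ∷ xs) (suc (suc r)) pos = s≤s (part-pos⇒≤length xs (suc r) pos)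

InD⇒row≤length : ∀ D {r c} → InD D r c → r ≤ length (outer D)
InD⇒row≤length D {r} (_ , start≤c , c<end) =
  part-pos⇒≤length (outer D) r (<-≤-trans 0<rowLength (m∸n≤m _ (part (inner D) r)))
  where
  0<rowLength : 0 < rowLength D r
  0<rowLength = +-cancelˡ-< (rowStart D r) 0 _
    (subst (_< rowStart D r + rowLength D r) (sym (+-identityʳ _)) (≤-<-trans start≤c c<end))

∈-cells⁻ : ∀ D {r c} → (r , c) ∈ cells D → InD D r c
∈-cells⁻ D ∈cells with Any.satisfied (∈-concatMap⁻ _ {xs = upTo (length (outer D))} ∈cells)
... | k , ∈row with ∈-rowCells⁻ D ∈row
... | refl , start≤c , c<end = s≤s z≤n , start≤c , c<end

∈-cells⁺ : ∀ D {r c} → InD D r c → (r , c) ∈ cells D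
∈-cells⁺ D {suc k} inD@(_ , start≤c , c<end) =
  ∈-concatMap⁺ _ (lose (∈-upTo⁺ (InD⇒row≤length D inD)) (∈-rowCells⁺ D start≤c c<end))

entryAt : ∀ {D} → Tableau D → Cell → Letter
entryAt T (r , c) = entry T r c

w≡map-entryAt-cells : ∀ {D} (T : Tableau D) → w T ≡ map (entryAt T) (cells D)
w≡map-entryAt-cells {D} T = trans
  (concatMap-cong (λ k → map-∘ (downFrom (rowLength D (suc k)))) (upTo (length (outer D))))
  (sym (map-concatMap (entryAt T) (λ k → rowCells D (suc k)) (upTo (length (outer D)))))

module _ {D : Diagram} {T : Tableau D} (amenable : Amenable T) where
  open Amenable amenable

  HasIndex : ℕ → Cell → Set
  HasIndex i p = index (entryAt T p) ≡ i

  RowBound : ℕ → Set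
  RowBound i = ∀ {p} → p ∈ cells D → HasIndex i p → i ≤ proj₁ p

  firstOccurrence-row : ∀ i → RowBound (suc i) →
    ∀ pre p post → cells D ≡ pre ++ p ∷ post →
    All (∁ (HasIndex (suc (suc i)))) pre → HasIndex (suc (suc i)) p → suc (suc i) ≤ proj₁ p
  firstOccurrence-row i bound pre p post cells≡ fresh p-index =
    predecessor-row (∈-map⁻ (entryAt T) plain∈pre)
    where
    word≡ : w T ++ ŵ T ≡ map (entryAt T) pre ++ entryAt T p ∷ (map (entryAt T) post ++ ŵ T)
    word≡ = begin
      w T ++ ŵ T                                                  ≡⟨ cong (_++ ŵ T) (w≡map-entryAt-cells T) ⟩
      map (entryAt T) (cells D) ++ ŵ T                             ≡⟨ cong (λ cs → map (entryAt T) cs ++ ŵ T) cells≡ ⟩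
      map (entryAt T) (pre ++ p ∷ post) ++ ŵ T                     ≡⟨ cong (_++ ŵ T) (map-++ (entryAt T) pre (p ∷ post)) ⟩
      (map (entryAt T) pre ++ map (entryAt T) (p ∷ post)) ++ ŵ T   ≡⟨ ++-assoc (map (entryAt T) pre) _ (ŵ T) ⟩
      map (entryAt T) pre ++ entryAt T p ∷ (map (entryAt T) post ++ ŵ T) ∎
      where open ≡-Reasoning

    plain∈pre : plain (suc i) ∈ map (entryAt T) pre
    plain∈pre = lattice⇒predecessor∈prefix lattice word≡ (s≤s z≤n) p-index (All.map⁺ fresh)

    ∈cells : ∀ {q} → q ∈ pre ++ p ∷ post → q ∈ cells D
    ∈cells = subst (_ ∈_) (sym cells≡)

    pre≺p : All (_≺ p) pre
    pre≺p = proj₁ (AllPairs-split pre (subst (AllPairs _≺_) cells≡ (cells-sorted D)))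

    predecessor-row : (∃ λ q → q ∈ pre × plain (suc i) ≡ entryAt T q) → suc (suc i) ≤ proj₁ p
    predecessor-row (q , q∈pre , plain≡) with All.lookup pre≺p q∈pre
    ... | earlierRow r<r′ = ≤-trans (s≤s (bound q∈cells (cong index (sym plain≡)))) r<r′
      where
      q∈cells : q ∈ cells D
      q∈cells = ∈cells (∈-++⁺ˡ q∈pre)
    ... | sameRowRight c′<c =
      ⊥-elim (<-irrefl refl (subst (_≤ suc i) p-index (index-mono-≤L {entryAt T p} {plain (suc i)} p≤q)))
      where
      p≤q : entryAt T p ≤L plain (suc i)
      p≤q = subst (entryAt T p ≤L_) (sym plain≡) (rowsWeak _ _ _
        (∈-cells⁻ D (∈cells (∈-++⁺ʳ pre (here refl)))) (∈-cells⁻ D (∈cells (∈-++⁺ˡ q∈pre))) (<⇒≤ c′<c))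

  rowBound-step : ∀ i → RowBound (suc i) → RowBound (suc (suc i))
  rowBound-step i bound {p₀} p₀∈ p₀-index
    with pre , p , post , cells≡ , fresh , p-index
           ← firstOccurrence (λ q → index (entryAt T q) ≟ suc (suc i)) (lose p₀∈ p₀-index)
    = ≤-trans (firstOccurrence-row i bound pre p post cells≡ fresh p-index)
              ([ (λ { refl → ≤-refl }) , ≺⇒row≤ ]′
                (first-precedes pre (subst (AllPairs _≺_) cells≡ (cells-sorted D)) fresh
                  (subst (p₀ ∈_) cells≡ p₀∈) p₀-index))

  rowBound : ∀ i → RowBound i
  rowBound zero          _  _ = z≤n
  rowBound (suc zero)    p∈ _ = proj₁ (∈-cells⁻ D p∈)
  rowBound (suc (suc i))      = rowBound-step i (rowBound (suc i))

mainTheorem7 : (D : Diagram) → ValidDiagram D → (T : Tableau D) → Amenable T →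
    ∀ (j c i : ℕ) → InD D j c → (entry T j c ≡ plain i ⊎ entry T j c ≡ prime i) → i ≤ j
mainTheorem7 D _ T amenable j c i inD entry≡ =
  rowBound amenable i (∈-cells⁺ D inD) ([ cong index , cong index ]′ entry≡)
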